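{- For every ideal $\mathcal{I}$ on $\omega$, $\mathfrak{b}(\mathcal{I})\leq\mathfrak{b}_R(\mathcal{I})$.
   Context: An ideal on a countable infinite set $X$ is a nonempty family $\mathcal{I}\subseteq\mathcal{P}(X)$ closed under finite unions and under subsets, containing all finite subsets of $X$, and with $X\notin\mathcal{I}$; $\mathcal{I}^+=\mathcal{P}(X)\setminus\mathcal{I}$. $\mathcal{D}_\mathcal{I}$ is the set of functions $f:X\to\omega$ with $f^{ -1}(\{n\})\in\mathcal{I}$ for all $n$. $\mathfrak{b}(\mathcal{I})$ is the least cardinality of a family $\mathcal{F}\subseteq\mathcal{D}_\mathcal{I}$ such that for every $g\in\mathcal{D}_\mathcal{I}$ there is $f\in\mathcal{F}$ with $\{x\in X: f(x)<g(x)\}\notin\mathcal{I}$. Families $\mathcal{A},\mathcal{B}\subseteq\mathcal{P}(X)$ are $\mathcal{I}$-orthogonal if $A\cap B\in\mathcal{I}$ for all $A\in\mathcal{A}$, $B\in\mathcal{B}$. A set $C\subseteq X$ $\mathcal{I}$-separates $(\mathcal{A},\mathcal{B})$ if $A\cap C\in\mathcal{I}$ and $B\setminus C\in\mathcal{I}$ for all $A\in\mathcal{A}$, $B\in\mathcal{B}$. An $\mathcal{I}$-gap is a pair $(\mathcal{A},\mathcal{B})$ of $\mathcal{I}$-orthogonal subfamilies of $\mathcal{I}^+$ not $\mathcal{I}$-separated by any $C\subseteq X$; it is an $\mathcal{I}$-$(\kappa,\lambda)$-gap if $|\mathcal{A}|=\kappa$, $|\mathcal{B}|=\lambda$. The Rothberger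 number $\mathfrak{b}_R(\mathcal{I})$ is the least $\kappa$ such that there is an $\mathcal{I}$-$(\omega,\kappa)$-gap, and $\mathfrak{c}^+$ if none exists. -}

module Defs where

open import Data.Nat using (ℕ; _<_; _<?_; _≟_)
open import Data.Bool using (Bool; true; false; _∧_; _∨_; not)
open import Data.Product using (Σ; ∃; _×_)
open import Relation.Nullary using (¬_)
open import Relation.Nullary.Decidable using (⌊_⌋)
open import Relation.Binary.PropositionalEquality using (_≡_)

Subset : Set
Subset = ℕ → Bool

_∈_ : ℕ → Subset → Set
x ∈ S = S x ≡ true

_⊆_ : Subset → Subset → Set
S ⊆ T = ∀ x → x ∈ S → x ∈ T

_∩_ : Subset → Subset → Subset
(S ∩ T) x = S x ∧ T x

_∪_ : Subset → Subset → Subset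
(S ∪ T) x = S x ∨ T x

_∖_ : Subset → Subset → Subset
(S ∖ T) x = S x ∧ not (T x)

∅ : Subset
∅ _ = false

ω : Subset
ω _ = true

Finite : Subset → Set
Finite S = ∃ λ n → ∀ x → x ∈ S → x < n

record IsIdeal (I : Subset → Set) : Set₁ where
  field
    nonempty   : ∃ λ S → I S
    ⊆-closed   : ∀ {S T} → S ⊆ T → I T → I S
    ∪-closed   : ∀ {S T} → I S → I T → I (S ∪ T)
    finite-in  : ∀ S → Finite S → I S
    ω-notin    : ¬ I ω

Positive : (Subset → Set) → Subset → Set
Positive I S = ¬ I S

fiber : (ℕ → ℕ) → ℕ → Subset
fiber f n x = ⌊ f x ≟ n ⌋

InD : (Subset → Set) → (ℕ → ℕ) → Set
InD I f = ∀ n → I (fiber f n)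

D : (Subset → Set) → Set
D I = Σ (ℕ → ℕ) (InD I)

lessSet : (ℕ → ℕ) → (ℕ → ℕ) → Subset
lessSet f g x = ⌊ f x <? g x ⌋

-- A family F ⊆ D_I (indexed by K) witnessing the definition of 𝔟(I):
-- for every g ∈ D_I there is f ∈ F with {x : f x < g x} ∉ I.
Unbounded : (I : Subset → Set) {K : Set} → (K → D I) → Set
Unbounded I {K} F =
  ∀ (g : D I) → ∃ λ (k : K) → ¬ I (lessSet (Σ.proj₁ (F k)) (Σ.proj₁ g))
  where open import Data.Product using (module Σ)

-- Injective indexing up to extensional equality of subsets
-- (so that the indexed family has exactly the cardinality of the index type).
ExtInjective : {J : Set} → (J → Subset) → Set
ExtInjective {J} A = ∀ (i j : J) → (∀ x → A i x ≡ A j x) → i ≡ j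

Orthogonal : (Subset → Set) → {J K : Set} → (J → Subset) → (K → Subset) → Set
Orthogonal I A B = ∀ j k → I (A j ∩ B k)

Separates : (Subset → Set) → {J K : Set} → Subset → (J → Subset) → (K → Subset) → Set
Separates I C A B = (∀ j → I (A j ∩ C)) × (∀ k → I (B k ∖ C))

IsGap : (Subset → Set) → {J K : Set} → (J → Subset) → (K → Subset) → Set
IsGap I A B =
  (∀ j → Positive I (A j)) × (∀ k → Positive I (B k)) ×
  Orthogonal I A B × (∀ (C : Subset) → ¬ Separates I C A B)

-- Part 1: each g ∈ D_I lies strictly above g ∸ 1 ∈ D_I off the fibre g⁻¹{0} ∈ I,
-- so D_I itself is an unbounded family.
-- Part 2: given an (ω, K)-gap (A, B), let f_k(x) be the least n with x ∈ A n ∩ B k,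
-- and x when there is none; orthogonality puts f_k in D_I. If some g ∈ D_I had
-- {f_k < g} ∈ I for every k, then C = {x : x ∉ A m for all m < g x} would separate
-- the gap, since A j ∩ C ⊆ {g ≤ j} and B k ∖ C ⊆ {f_k < g}. So {f_k : k ∈ K} is
-- unbounded, and |K| ≥ 𝔟(I).
module Submission where

open import Defs
open import Level using (0ℓ)
open import Data.Nat using (ℕ)
open import Data.Product using (Σ; _×_; proj₁)
open import Axiom.ExcludedMiddle using (ExcludedMiddle)

open import Data.Bool using (true; false; not)
import Data.Bool.Properties as Bool
open import Data.Empty using (⊥-elim)
open import Data.Nat using (zero; suc; pred; _≤_; _<_; _≟_; _<?_; _≤?_; s≤s)
open import Data.Nat.Induction using (<-wellFounded)
open import Data.Nat.Properties
  using (≮⇒≥; ≤-reflexive; ≤-<-trans; m≤n⇒m<n∨m≡n; n≤0⇒n≡0; ≤-pred; n<1+n; anyUpTo?)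
open import Data.Product using (_,_; ∃; proj₂)
open import Data.Sum using (_⊎_; inj₁; inj₂)
open import Induction.WellFounded using (Acc; acc)
open import Relation.Nullary using (Dec; yes; no; ¬_)
open import Relation.Nullary.Decidable using (⌊_⌋; decidable-stable)
open import Relation.Binary.PropositionalEquality using (_≡_; refl; cong)
open import Relation.Unary using (Decidable)

from-⌊⌋ : ∀ {P : Set} (d : Dec P) → ⌊ d ⌋ ≡ true → P
from-⌊⌋ (yes p) _ = p

to-⌊⌋ : ∀ {P : Set} (d : Dec P) → P → ⌊ d ⌋ ≡ true
to-⌊⌋ (yes _) _ = refl
to-⌊⌋ (no ¬p) p = ⊥-elim (¬p p)

_∈?_ : ∀ x S → Dec (x ∈ S)
x ∈? S = S x Bool.≟ true

_∉_ : ℕ → Subset → Set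
x ∉ S = ¬ x ∈ S

∈-∩⁺ : ∀ S T {x} → x ∈ S → x ∈ T → x ∈ (S ∩ T)
∈-∩⁺ S T {x} x∈S x∈T with S x
... | true = x∈T

∈-∩⁻ : ∀ S T {x} → x ∈ (S ∩ T) → x ∈ S × x ∈ T
∈-∩⁻ S T {x} x∈S∩T with S x
... | true = refl , x∈S∩T

∈-∪⁺ˡ : ∀ S T {x} → x ∈ S → x ∈ (S ∪ T)
∈-∪⁺ˡ S T {x} x∈S with S x
... | true = refl

∈-∪⁺ʳ : ∀ S T {x} → x ∈ T → x ∈ (S ∪ T)
∈-∪⁺ʳ S T {x} x∈T with S x
... | true = refl
... | false = x∈T

∈-∖⁻ : ∀ S T {x} → x ∈ (S ∖ T) → x ∈ S × x ∉ T
∈-∖⁻ S T {x} x∈S∖T with S x | T x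
... | true | false = refl , λ ()

least-witness : ∀ {P : ℕ → Set} → Decidable P → ∀ {w} → P w →
  ∃ λ m → P m × (∀ {j} → P j → m ≤ j)
least-witness {P} P? Pw = go (<-wellFounded _) Pw
  where
  go : ∀ {w} → Acc _<_ w → P w → ∃ λ m → P m × (∀ {j} → P j → m ≤ j)
  go {w} (acc rs) Pw with anyUpTo? P? w
  ... | yes (n , n<w , Pn) = go (rs n<w) Pn
  ... | no none = w , Pw , λ Pj → ≮⇒≥ (λ j<w → none (_ , j<w , Pj))

∃¬-of-¬∀ : ExcludedMiddle 0ℓ → ∀ {K : Set} {P : K → Set} → ¬ (∀ k → P k) → ∃ λ k → ¬ P k
∃¬-of-¬∀ em ¬∀ = decidable-stable em λ ¬∃ → ¬∀ λ k → decidable-stable em λ ¬Pk → ¬∃ (k , ¬Pk)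

pred-preimage : ∀ m {n} → pred m ≡ n → m ≡ n ⊎ m ≡ suc n
pred-preimage zero    0≡n = inj₁ 0≡n
pred-preimage (suc m) m≡n = inj₂ (cong suc m≡n)

zero-or-pred< : ∀ m → m ≡ 0 ⊎ pred m < m
zero-or-pred< zero    = inj₁ refl
zero-or-pred< (suc m) = inj₂ (n<1+n m)

singleton : ℕ → Subset
singleton n x = ⌊ x ≟ n ⌋

atMost : (ℕ → ℕ) → ℕ → Subset
atMost g j x = ⌊ g x ≤? j ⌋

module _ {I : Subset → Set} (ideal : IsIdeal I) where
  open IsIdeal ideal

  ⊆-∪-closed : ∀ {S T U} → S ⊆ (T ∪ U) → I T → I U → I S
  ⊆-∪-closed S⊆T∪U T∈I U∈I = ⊆-closed S⊆T∪U (∪-closed T∈I U∈I)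

  singleton∈I : ∀ n → I (singleton n)
  singleton∈I n = finite-in _ (suc n , λ x x≡n → s≤s (≤-reflexive (from-⌊⌋ (x ≟ n) x≡n)))

  atMost∈I : ∀ {g} → InD I g → ∀ j → I (atMost g j)
  atMost∈I {g} g∈D zero =
    ⊆-closed (λ x p → to-⌊⌋ (g x ≟ 0) (n≤0⇒n≡0 (from-⌊⌋ (g x ≤? 0) p))) (g∈D 0)
  atMost∈I {g} g∈D (suc j) = ⊆-∪-closed split (atMost∈I g∈D j) (g∈D (suc j))
    where
    split : atMost g (suc j) ⊆ (atMost g j ∪ fiber g (suc j))
    split x p with m≤n⇒m<n∨m≡n (from-⌊⌋ (g x ≤? suc j) p)
    ... | inj₁ gx<1+j = ∈-∪⁺ˡ (atMost g j) (fiber g (suc j)) (to-⌊⌋ (g x ≤? j) (≤-pred gx<1+j))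
    ... | inj₂ gx≡1+j = ∈-∪⁺ʳ (atMost g j) (fiber g (suc j)) (to-⌊⌋ (g x ≟ suc j) gx≡1+j)

  pred∘-∈D : ∀ {g} → InD I g → InD I (λ x → pred (g x))
  pred∘-∈D {g} g∈D n = ⊆-∪-closed split (g∈D n) (g∈D (suc n))
    where
    split : fiber (λ x → pred (g x)) n ⊆ (fiber g n ∪ fiber g (suc n))
    split x p with pred-preimage (g x) (from-⌊⌋ (pred (g x) ≟ n) p)
    ... | inj₁ gx≡n   = ∈-∪⁺ˡ (fiber g n) (fiber g (suc n)) (to-⌊⌋ (g x ≟ n) gx≡n)
    ... | inj₂ gx≡1+n = ∈-∪⁺ʳ (fiber g n) (fiber g (suc n)) (to-⌊⌋ (g x ≟ suc n) gx≡1+n)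

  D-unbounded : Unbounded I {D I} (λ f → f)
  D-unbounded (g , g∈D) = (pred∘g , pred∘-∈D g∈D) , pred∘g<g∉I
    where
    pred∘g : ℕ → ℕ
    pred∘g x = pred (g x)
    cover : ω ⊆ (fiber g 0 ∪ lessSet pred∘g g)
    cover x _ with zero-or-pred< (g x)
    ... | inj₁ gx≡0    = ∈-∪⁺ˡ (fiber g 0) (lessSet pred∘g g) (to-⌊⌋ (g x ≟ 0) gx≡0)
    ... | inj₂ pred<gx = ∈-∪⁺ʳ (fiber g 0) (lessSet pred∘g g) (to-⌊⌋ (pred∘g x <? g x) pred<gx)
    pred∘g<g∉I : ¬ I (lessSet pred∘g g)
    pred∘g<g∉I pred∘g<g∈I = ω-notin (⊆-∪-closed cover (g∈D 0) pred∘g<g∈I)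

  module _ (em : ExcludedMiddle 0ℓ) (S : ℕ → Subset) where

    least-member : ∀ x → Dec (∃ λ m → x ∈ S m) → ℕ
    least-member x (yes (_ , x∈Sm)) = proj₁ (least-witness (λ m → x ∈? S m) x∈Sm)
    least-member x (no _) = x

    least-member-fiber : ∀ {x n} d → least-member x d ≡ n → x ∈ S n ⊎ x ≡ n
    least-member-fiber {x} (yes (_ , x∈Sm)) refl =
      inj₁ (proj₁ (proj₂ (least-witness (λ m → x ∈? S m) x∈Sm)))
    least-member-fiber (no _) eq = inj₂ eq

    least-member-minimal : ∀ {x m} d → x ∈ S m → least-member x d ≤ m
    least-member-minimal {x} (yes (_ , x∈Sm)) x∈S =
      proj₂ (proj₂ (least-witness (λ m → x ∈? S m) x∈Sm)) x∈S
    least-member-minimal (no ∄) x∈S = ⊥-elim (∄ (_ , x∈S))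

    firstIndex : ℕ → ℕ
    firstIndex x = least-member x em

    firstIndex∈D : (∀ n → I (S n)) → InD I firstIndex
    firstIndex∈D S∈I n = ⊆-∪-closed split (S∈I n) (singleton∈I n)
      where
      split : fiber firstIndex n ⊆ (S n ∪ singleton n)
      split x p with least-member-fiber em (from-⌊⌋ (firstIndex x ≟ n) p)
      ... | inj₁ x∈Sn = ∈-∪⁺ˡ (S n) (singleton n) x∈Sn
      ... | inj₂ x≡n = ∈-∪⁺ʳ (S n) (singleton n) (to-⌊⌋ (x ≟ n) x≡n)

    firstIndex-minimal : ∀ {x m} → x ∈ S m → firstIndex x ≤ m
    firstIndex-minimal = least-member-minimal em

  module _ (em : ExcludedMiddle 0ℓ) {K : Set} (A : ℕ → Subset) (B : K → Subset) where

    gapFamily : K → ℕ → ℕ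
    gapFamily k = firstIndex em (λ n → A n ∩ B k)

    gapFamily∈D : Orthogonal I A B → ∀ k → InD I (gapFamily k)
    gapFamily∈D orth k = firstIndex∈D em (λ n → A n ∩ B k) (λ n → orth n k)

    gapFamilyD : Orthogonal I A B → K → D I
    gapFamilyD orth k = gapFamily k , gapFamily∈D orth k

    missesBelow : (ℕ → ℕ) → Subset
    missesBelow g x = not ⌊ anyUpTo? (λ m → x ∈? A m) (g x) ⌋

    missesBelow⇒≤ : ∀ {g x m} → x ∈ missesBelow g → x ∈ A m → g x ≤ m
    missesBelow⇒≤ {g} {x} x∈C x∈Am with anyUpTo? (λ m → x ∈? A m) (g x)
    ... | no none = ≮⇒≥ λ m<gx → none (_ , m<gx , x∈Am)

    ∉missesBelow⇒hit : ∀ {g x} → x ∉ missesBelow g → ∃ λ m → m < g x × x ∈ A m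
    ∉missesBelow⇒hit {g} {x} x∉C with anyUpTo? (λ m → x ∈? A m) (g x)
    ... | yes hit = hit
    ... | no _ = ⊥-elim (x∉C refl)

    dominating⇒separates : ∀ {g} → InD I g → (∀ k → I (lessSet (gapFamily k) g)) →
      Separates I (missesBelow g) A B
    dominating⇒separates {g} g∈D f<g∈I = A∩C∈I , B∖C∈I
      where
      A∩C∈I : ∀ j → I (A j ∩ missesBelow g)
      A∩C∈I j = ⊆-closed A∩C⊆atMost (atMost∈I g∈D j)
        where
        A∩C⊆atMost : (A j ∩ missesBelow g) ⊆ atMost g j
        A∩C⊆atMost x p with ∈-∩⁻ (A j) (missesBelow g) p
        ... | x∈Aj , x∈C = to-⌊⌋ (g x ≤? j) (missesBelow⇒≤ {g} x∈C x∈Aj)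
      B∖C∈I : ∀ k → I (B k ∖ missesBelow g)
      B∖C∈I k = ⊆-closed B∖C⊆f<g (f<g∈I k)
        where
        B∖C⊆f<g : (B k ∖ missesBelow g) ⊆ lessSet (gapFamily k) g
        B∖C⊆f<g x p with ∈-∖⁻ (B k) (missesBelow g) p
        ... | x∈Bk , x∉C with ∉missesBelow⇒hit {g} x∉C
        ...   | m , m<gx , x∈Am =
          to-⌊⌋ (gapFamily k x <? g x)
                (≤-<-trans (firstIndex-minimal em _ (∈-∩⁺ (A m) (B k) x∈Am x∈Bk)) m<gx)

    gapFamily-unbounded : (orth : Orthogonal I A B) → (∀ C → ¬ Separates I C A B) →
      Unbounded I (gapFamilyD orth)
    gapFamily-unbounded _ inseparable (g , g∈D) =
      ∃¬-of-¬∀ em λ f<g∈I → inseparable (missesBelow g) (dominating⇒separates g∈D f<g∈I)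

theorem3p2 : ExcludedMiddle 0ℓ → (I : Subset → Set) → IsIdeal I →
    Unbounded I {D I} (λ f → f) ×
      (∀ (K : Set) (A : ℕ → Subset) (B : K → Subset) →
        ExtInjective A → ExtInjective B → IsGap I A B →
        Σ (K → D I) (Unbounded I))
theorem3p2 em I ideal = D-unbounded ideal , gap⇒unbounded
  where
  gap⇒unbounded : ∀ (K : Set) (A : ℕ → Subset) (B : K → Subset) →
    ExtInjective A → ExtInjective B → IsGap I A B → Σ (K → D I) (Unbounded I)
  gap⇒unbounded K A B _ _ (_ , _ , orth , inseparable) =
    gapFamilyD ideal em A B orth , gapFamily-unbounded ideal em A B orth inseparable
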